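{- Let $q\ge2$ be a prime power and let $n,k,t,s,l$ be positive integers with $k\ge t+1$ and $n\ge 2k+2t+1+\log_q(7sl)$. Define, for integers $x$, $$f_1(n,k,t,s,x)={x\brack t}{k-t+1\brack 1}^{x-t}{n-x\brack k-x}+s{x\brack t}\sum_{i=0}^{x-t-1}{k-t+1\brack 1}^i.$$ Then (i) $f_1(n,k,t,s,x)$ is decreasing as $x\in\{t,t+1,\dots,k-1\}$ increases; and (ii) $f_1(n,k,t,s,k-1)>\frac{7l}{6}\,s{k\brack t}\binom{2k-2t+2}{k-t+1}$.
   Context: Gaussian binomial: ${a\brack b}=\prod_{0\le i<b}\frac{q^{a-i}-1}{q^{b-i}-1}$ for positive integers $a,b$, ${a\brack 0}=1$, ${a\brack b}=0$ for $b<0$. $\binom{\cdot}{\cdot}$ is the ordinary binomial coefficient. -}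

module Defs where

open import Data.Nat using (ℕ; zero; suc; _+_; _*_; _∸_; _^_; _/_; _≤_; _<_)
open import Data.Nat.Primality using (Prime)
open import Data.Product using (Σ; _×_)
open import Relation.Binary.PropositionalEquality using (_≡_)

IsPrimePower : ℕ → Set
IsPrimePower q = Σ ℕ λ p → Σ ℕ λ e → Prime p × (1 ≤ e × q ≡ p ^ e)

prod : ℕ → (ℕ → ℕ) → ℕ
prod zero    g = 1
prod (suc b) g = prod b g * g b

sumTo : ℕ → (ℕ → ℕ) → ℕ
sumTo zero    g = 0
sumTo (suc m) g = sumTo m g + g m

-- division, with the (never used) convention m / 0 = 0
divOr0 : ℕ → ℕ → ℕ
divOr0 m zero    = 0
divOr0 m (suc d) = m / suc d

-- For q ≥ 2 the denominator is nonzero and the quotient is exact.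
gauss : ℕ → ℕ → ℕ → ℕ
gauss q a b = divOr0 (prod b (λ i → q ^ (a ∸ i) ∸ 1)) (prod b (λ i → q ^ (b ∸ i) ∸ 1))

-- f₁(n,k,t,s,x) (for x ≥ t, x ≤ k, all arguments natural)
f1 : ℕ → ℕ → ℕ → ℕ → ℕ → ℕ → ℕ
f1 q n k t s x =
  gauss q x t * (gauss q (suc (k ∸ t)) 1 ^ (x ∸ t)) * gauss q (n ∸ x) (k ∸ x)
  + s * gauss q x t * sumTo (x ∸ t) (λ i → gauss q (suc (k ∸ t)) 1 ^ i)

{-# OPTIONS --safe #-}
module Submission where

open import Defs
open import Data.Nat
  using (ℕ; zero; suc; _+_; _*_; _∸_; _^_; _≤_; _<_; z≤n; s≤s; s≤s⁻¹; NonZero; >-nonZero; nonTrivial⇒n>1)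
open import Data.Nat.Properties
open import Algebra.Properties.CommutativeSemigroup *-commutativeSemigroup using (xy∙z≈xz∙y)
open import Data.Nat.DivMod using (m*n/n≡m)
open import Data.Nat.Combinatorics using (_C_; nCk+nC[k+1]≡[n+1]C[k+1])
open import Data.Nat.Primality using (prime⇒nonTrivial)
open import Data.Nat.Tactic.RingSolver using (solve-∀)
open import Data.Product using (_×_; _,_)
open import Data.Sum using (inj₁; inj₂)
open import Relation.Binary.PropositionalEquality
open import Relation.Nullary using (yes; no)

-- For q ≥ 2 the product formula defining gauss is exact: it equals the Gaussian
-- binomial given by the q-Pascal rule, whose consecutive values obey the absorption
-- identities [a+1,b+1](q^(b+1) - 1) = (q^(a+1) - 1)[a,b] and
-- [b+a+1,b](q^(a+1) - 1) = (q^(b+a+1) - 1)[b+a,b].  With A = [k-t+1,1] one has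
-- f₁(x) = [x,t] (A^(x-t) [n-x,k-x] + s Σ_{i<x-t} A^i), and the geometric sum is below A^(x-t).
-- Cross-multiplying f₁(x+1) < f₁(x) by the absorption denominators leaves a comparison of
-- powers of q, won by the surplus q^(n-2k-2t-1) ≥ 7sl > s.  For (ii), f₁(k-1) is at least
-- [k-1,t] A^(k-1-t) q^(n-k), the binomial coefficient is at most 2^(2k-2t+2), and the same
-- surplus absorbs 7sl.

∸-≡ : ∀ {m} n {o} → n + o ≡ m → m ∸ n ≡ o
∸-≡ n {o} refl = m+n∸m≡n n o

^-distribˡ-+-*₃ : ∀ m i j k → m ^ (i + j + k) ≡ m ^ i * m ^ j * m ^ k
^-distribˡ-+-*₃ m i j k =
  trans (^-distribˡ-+-* m (i + j) k) (cong (_* m ^ k) (^-distribˡ-+-* m i j))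

divOr0[m*n,n]≡m : ∀ m {n} → 1 ≤ n → divOr0 (m * n) n ≡ m
divOr0[m*n,n]≡m m {suc n} _ = m*n/n≡m m (suc n)

prod-unfoldˡ : ∀ b g → prod (suc b) g ≡ g 0 * prod b (λ i → g (suc i))
prod-unfoldˡ zero    g = *-comm 1 (g 0)
prod-unfoldˡ (suc b) g = begin
  prod (suc b) g * g (suc b)                  ≡⟨ cong (_* g (suc b)) (prod-unfoldˡ b g) ⟩
  g 0 * prod b (λ i → g (suc i)) * g (suc b)  ≡⟨ *-assoc (g 0) _ _ ⟩
  g 0 * (prod b (λ i → g (suc i)) * g (suc b))  ∎
  where open ≡-Reasoning

prod-≡0 : ∀ {b i} g → i < b → g i ≡ 0 → prod b g ≡ 0
prod-≡0 {suc b} g i<1+b gi≡0 with m≤n⇒m<n∨m≡n (s≤s⁻¹ i<1+b)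
... | inj₁ i<b  = cong (_* g b) (prod-≡0 g i<b gi≡0)
... | inj₂ refl = trans (cong (prod b g *_) gi≡0) (*-zeroʳ (prod b g))

prod-pos : ∀ b g → (∀ i → i < b → 1 ≤ g i) → 1 ≤ prod b g
prod-pos zero    g _   = ≤-refl
prod-pos (suc b) g pos = *-mono-≤ (prod-pos b g (λ i i<b → pos i (m<n⇒m<1+n i<b))) (pos b ≤-refl)

sumTo-pow< : ∀ {A} j → 2 ≤ A → sumTo j (A ^_) < A ^ j
sumTo-pow< zero    _   = s≤s z≤n
sumTo-pow< {A} (suc j) 2≤A = begin-strict
  sumTo j (A ^_) + A ^ j  <⟨ +-monoˡ-< (A ^ j) (sumTo-pow< j 2≤A) ⟩
  A ^ j + A ^ j           ≡⟨ cong (A ^ j +_) (sym (+-identityʳ (A ^ j))) ⟩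
  2 * A ^ j               ≤⟨ *-monoˡ-≤ (A ^ j) 2≤A ⟩
  A * A ^ j               ∎
  where open ≤-Reasoning

nCk≤2^n : ∀ n k → n C k ≤ 2 ^ n
nCk≤2^n zero    zero    = ≤-refl
nCk≤2^n zero    (suc k) = z≤n
nCk≤2^n (suc n) zero    = m^n>0 2 (suc n)
nCk≤2^n (suc n) (suc k) = begin
  suc n C suc k        ≡⟨ sym (nCk+nC[k+1]≡[n+1]C[k+1] n k) ⟩
  n C k + n C suc k    ≤⟨ +-mono-≤ (nCk≤2^n n k) (nCk≤2^n n (suc k)) ⟩
  2 ^ n + 2 ^ n        ≡⟨ cong (2 ^ n +_) (sym (+-identityʳ (2 ^ n))) ⟩
  2 * 2 ^ n            ∎
  where open ≤-Reasoning

binomial-bound : ∀ t a k j → t + suc a ≡ k → (2 * k ∸ 2 * t + 2) C j ≤ 16 * (2 ^ a * 2 ^ a)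
binomial-bound t a k j t+[1+a]≡k = ≤-trans (nCk≤2^n (2 * k ∸ 2 * t + 2) j) (≤-reflexive (begin
  2 ^ (2 * k ∸ 2 * t + 2)    ≡⟨ cong (λ m → 2 ^ (m + 2)) (∸-≡ (2 * t) 2t+2[1+a]≡2k) ⟩
  2 ^ (2 * suc a + 2)        ≡⟨ cong (2 ^_) (double a) ⟩
  2 ^ (4 + (a + a))          ≡⟨ ^-distribˡ-+-* 2 4 (a + a) ⟩
  16 * 2 ^ (a + a)           ≡⟨ cong (16 *_) (^-distribˡ-+-* 2 a a) ⟩
  16 * (2 ^ a * 2 ^ a)       ∎))
  where
  open ≡-Reasoning
  2t+2[1+a]≡2k : 2 * t + 2 * suc a ≡ 2 * k
  2t+2[1+a]≡2k = trans (sym (*-distribˡ-+ 2 t (suc a))) (cong (2 *_) t+[1+a]≡k)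
  double : ∀ a → 2 * suc a + 2 ≡ 4 + (a + a)
  double = solve-∀

2≤primePower : ∀ {q} → IsPrimePower q → 2 ≤ q
2≤primePower (p , zero  , _       , () , _)
2≤primePower (p , suc e , p-prime , _  , refl) = ≤-trans 2≤p (m≤m*n p (p ^ e) {{m^n≢0 p e}})
  where
  2≤p : 2 ≤ p
  2≤p = nonTrivial⇒n>1 p {{prime⇒nonTrivial p-prime}}
  instance
    p≢0 : NonZero p
    p≢0 = >-nonZero (≤-trans (s≤s z≤n) 2≤p)

m+n≤o*m : ∀ {m n o} → 1 ≤ m → n < o → m + n ≤ o * m
m+n≤o*m {m} {n} 1≤m n<o =
  ≤-trans (+-monoʳ-≤ m (m≤m*n n m {{>-nonZero 1≤m}})) (*-monoˡ-≤ m n<o)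

-- Writing [a,b] for gauss q a b, f1 q n k t s x unfolds to
-- f1-shape s [x,t] [k∸t+1,1] [n∸x,k∸x] (x ∸ t).
f1-shape : ℕ → ℕ → ℕ → ℕ → ℕ → ℕ
f1-shape s g A N j = g * A ^ j * N + s * g * sumTo j (A ^_)

f1-shape-upper : ∀ s g A N j → 2 ≤ A → f1-shape s g A N j ≤ g * A ^ j * (N + s)
f1-shape-upper s g A N j 2≤A = begin
  g * A ^ j * N + s * g * sumTo j (A ^_)
    ≤⟨ +-monoʳ-≤ (g * A ^ j * N) (*-monoʳ-≤ (s * g) (<⇒≤ (sumTo-pow< j 2≤A))) ⟩
  g * A ^ j * N + s * g * A ^ j           ≡⟨ factor g (A ^ j) N s ⟩
  g * A ^ j * (N + s)                     ∎
  where
  open ≤-Reasoning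
  factor : ∀ g a N s → g * a * N + s * g * a ≡ g * a * (N + s)
  factor = solve-∀

f1-shape-decreasing : ∀ s g₀ g₁ A N₀ N₁ {d e d′ e′} j
  → g₁ * d ≡ e * g₀ → N₀ * d′ ≡ e′ * N₁ → 2 ≤ A → 1 ≤ g₀
  → e * A * (N₁ + s) * d′ < d * e′ * N₁
  → f1-shape s g₁ A N₁ (suc j) < f1-shape s g₀ A N₀ j
f1-shape-decreasing s g₀ g₁ A N₀ N₁ {d} {e} {d′} {e′} j g-ratio N-ratio 2≤A 1≤g₀ key =
  begin-strict
    f1-shape s g₁ A N₁ (suc j)  ≤⟨ f1-shape-upper s g₁ A N₁ (suc j) 2≤A ⟩
    g₁ * A ^ suc j * (N₁ + s)   <⟨ *-cancelʳ-< (d * d′) _ _ cross ⟩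
    g₀ * A ^ j * N₀             ≤⟨ m≤m+n _ _ ⟩
    f1-shape s g₀ A N₀ j        ∎
  where
  open ≤-Reasoning
  1≤g₀Aʲ : 1 ≤ g₀ * A ^ j
  1≤g₀Aʲ = *-mono-≤ 1≤g₀ (m^n>0 A {{>-nonZero (≤-trans (s≤s z≤n) 2≤A)}} j)
  cross : g₁ * A ^ suc j * (N₁ + s) * (d * d′) < g₀ * A ^ j * N₀ * (d * d′)
  cross = begin-strict
    g₁ * A ^ suc j * (N₁ + s) * (d * d′)     ≡⟨ regroup₁ g₁ A (A ^ j) N₁ s d d′ ⟩
    g₁ * d * (A ^ j * (A * (N₁ + s) * d′))   ≡⟨ cong (_* (A ^ j * (A * (N₁ + s) * d′))) g-ratio ⟩
    e * g₀ * (A ^ j * (A * (N₁ + s) * d′))   ≡⟨ regroup₂ e g₀ (A ^ j) A N₁ s d′ ⟩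
    g₀ * A ^ j * (e * A * (N₁ + s) * d′)     <⟨ *-monoʳ-< (g₀ * A ^ j) {{>-nonZero 1≤g₀Aʲ}} key ⟩
    g₀ * A ^ j * (d * e′ * N₁)               ≡⟨ regroup₃ (g₀ * A ^ j) d e′ N₁ ⟩
    g₀ * A ^ j * d * (e′ * N₁)               ≡˘⟨ cong (g₀ * A ^ j * d *_) N-ratio ⟩
    g₀ * A ^ j * d * (N₀ * d′)               ≡⟨ regroup₄ (g₀ * A ^ j) d N₀ d′ ⟩
    g₀ * A ^ j * N₀ * (d * d′)               ∎
    where
    regroup₁ : ∀ g A Aʲ N s d d′ → g * (A * Aʲ) * (N + s) * (d * d′) ≡ g * d * (Aʲ * (A * (N + s) * d′))
    regroup₁ = solve-∀
    regroup₂ : ∀ e g Aʲ A N s d′ → e * g * (Aʲ * (A * (N + s) * d′)) ≡ g * Aʲ * (e * A * (N + s) * d′)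
    regroup₂ = solve-∀
    regroup₃ : ∀ G d e N → G * (d * e * N) ≡ G * d * (e * N)
    regroup₃ = solve-∀
    regroup₄ : ∀ G d N d′ → G * d * (N * d′) ≡ G * N * (d * d′)
    regroup₄ = solve-∀

module GaussianBinomial (q : ℕ) (2≤q : 2 ≤ q) where

  instance
    q≢0 : NonZero q
    q≢0 = >-nonZero (≤-trans (s≤s z≤n) 2≤q)

  q^_∸1 : ℕ → ℕ
  q^ j ∸1 = q ^ j ∸ 1

  q^≡1+q^∸1 : ∀ j → q ^ j ≡ suc (q^ j ∸1)
  q^≡1+q^∸1 j = sym (m+[n∸m]≡n (m^n>0 q j))

  q^∸1<q^ : ∀ j → q^ j ∸1 < q ^ j
  q^∸1<q^ j = ≤-reflexive (sym (q^≡1+q^∸1 j))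

  q^<q^suc : ∀ j → q ^ j < q ^ suc j
  q^<q^suc j = subst (q ^ j <_) (*-comm (q ^ j) q) (m<m*n (q ^ j) q {{m^n≢0 q j}} 2≤q)

  q^≤q^suc∸1 : ∀ j → q ^ j ≤ q^ suc j ∸1
  q^≤q^suc∸1 j = ∸-monoˡ-≤ 1 (q^<q^suc j)

  1≤q^∸1 : ∀ {m} → 1 ≤ m → 1 ≤ q^ m ∸1
  1≤q^∸1 {suc j} _ = ≤-trans (m^n>0 q j) (q^≤q^suc∸1 j)

  q^∸1-+ : ∀ m d → q^ m ∸1 + q ^ m * q^ d ∸1 ≡ q^ (m + d) ∸1
  q^∸1-+ m d = suc-injective (begin
    suc (q^ m ∸1) + q ^ m * q^ d ∸1  ≡⟨ cong (_+ q ^ m * q^ d ∸1) (sym (q^≡1+q^∸1 m)) ⟩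
    q ^ m + q ^ m * q^ d ∸1          ≡⟨ sym (*-suc (q ^ m) (q^ d ∸1)) ⟩
    q ^ m * suc (q^ d ∸1)            ≡⟨ cong (q ^ m *_) (sym (q^≡1+q^∸1 d)) ⟩
    q ^ m * q ^ d                    ≡⟨ sym (^-distribˡ-+-* q m d) ⟩
    q ^ (m + d)                      ≡⟨ q^≡1+q^∸1 (m + d) ⟩
    suc (q^ (m + d) ∸1)              ∎)
    where open ≡-Reasoning

  qBinom : ℕ → ℕ → ℕ
  qBinom a       zero    = 1
  qBinom zero    (suc b) = 0
  qBinom (suc a) (suc b) = qBinom a b + q ^ suc b * qBinom a (suc b)

  qFalling : ℕ → ℕ → ℕ
  qFalling a b = prod b (λ i → q^ (a ∸ i) ∸1)

  qFactorial : ℕ → ℕ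
  qFactorial b = qFalling b b

  qFalling-suc-suc : ∀ a b → qFalling (suc a) (suc b) ≡ q^ suc a ∸1 * qFalling a b
  qFalling-suc-suc a b = prod-unfoldˡ b (λ i → q^ (suc a ∸ i) ∸1)

  qFalling-≡0 : ∀ {a b} → a < b → qFalling a b ≡ 0
  qFalling-≡0 {a} a<b = prod-≡0 _ a<b (cong q^_∸1 (n∸n≡0 a))

  1≤qFactorial : ∀ b → 1 ≤ qFactorial b
  1≤qFactorial b = prod-pos b _ (λ i i<b → 1≤q^∸1 (m<n⇒0<n∸m i<b))

  qFalling-pascal : ∀ a b →
    q^ suc a ∸1 * qFalling a b ≡ q^ suc b ∸1 * qFalling a b + q ^ suc b * qFalling a (suc b)
  qFalling-pascal a b with b ≤? a
  ... | yes b≤a = begin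
    q^ suc a ∸1 * F                                        ≡⟨ cong (_* F) (sym split) ⟩
    (q^ suc b ∸1 + q ^ suc b * q^ (a ∸ b) ∸1) * F          ≡⟨ distrib (q^ suc b ∸1) (q ^ suc b) _ F ⟩
    q^ suc b ∸1 * F + q ^ suc b * (F * q^ (a ∸ b) ∸1)      ∎
    where
    open ≡-Reasoning
    F = qFalling a b
    split : q^ suc b ∸1 + q ^ suc b * q^ (a ∸ b) ∸1 ≡ q^ suc a ∸1
    split = trans (q^∸1-+ (suc b) (a ∸ b)) (cong (λ m → q^ suc m ∸1) (m+[n∸m]≡n b≤a))
    distrib : ∀ u v w F → (u + v * w) * F ≡ u * F + v * (F * w)
    distrib = solve-∀
  ... | no b≰a
    rewrite qFalling-≡0 (≰⇒> b≰a) =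
    trans (*-zeroʳ (q^ suc a ∸1)) (sym (cong₂ _+_ (*-zeroʳ (q^ suc b ∸1)) (*-zeroʳ (q ^ suc b))))

  qFalling≡qBinom*qFactorial : ∀ a b → qFalling a b ≡ qBinom a b * qFactorial b
  qFalling≡qBinom*qFactorial a       zero    = refl
  qFalling≡qBinom*qFactorial zero    (suc b) = qFalling-≡0 {0} {suc b} (s≤s z≤n)
  qFalling≡qBinom*qFactorial (suc a) (suc b) = begin
    qFalling (suc a) (suc b)                                   ≡⟨ qFalling-suc-suc a b ⟩
    q^ suc a ∸1 * qFalling a b                                 ≡⟨ qFalling-pascal a b ⟩
    q^ suc b ∸1 * qFalling a b + q ^ suc b * qFalling a (suc b)
      ≡⟨ cong₂ (λ u v → q^ suc b ∸1 * u + q ^ suc b * v)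
               (qFalling≡qBinom*qFactorial a b) (qFalling≡qBinom*qFactorial a (suc b)) ⟩
    q^ suc b ∸1 * (qBinom a b * qFactorial b) + q ^ suc b * (qBinom a (suc b) * qFactorial (suc b))
      ≡⟨ cong (λ u → q^ suc b ∸1 * (qBinom a b * qFactorial b) + q ^ suc b * (qBinom a (suc b) * u))
              (qFalling-suc-suc b b) ⟩
    q^ suc b ∸1 * (qBinom a b * qFactorial b) + q ^ suc b * (qBinom a (suc b) * (q^ suc b ∸1 * qFactorial b))
      ≡⟨ collect (q^ suc b ∸1) (qBinom a b) (qFactorial b) (q ^ suc b) (qBinom a (suc b)) ⟩
    qBinom (suc a) (suc b) * (q^ suc b ∸1 * qFactorial b)
      ≡˘⟨ cong (qBinom (suc a) (suc b) *_) (qFalling-suc-suc b b) ⟩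
    qBinom (suc a) (suc b) * qFactorial (suc b)                ∎
    where
    open ≡-Reasoning
    collect : ∀ e g D Q h → e * (g * D) + Q * (h * (e * D)) ≡ (g + Q * h) * (e * D)
    collect = solve-∀

  gauss≡qBinom : ∀ a b → gauss q a b ≡ qBinom a b
  gauss≡qBinom a b = begin
    divOr0 (qFalling a b) (qFactorial b)
      ≡⟨ cong (λ m → divOr0 m (qFactorial b)) (qFalling≡qBinom*qFactorial a b) ⟩
    divOr0 (qBinom a b * qFactorial b) (qFactorial b)    ≡⟨ divOr0[m*n,n]≡m (qBinom a b) (1≤qFactorial b) ⟩
    qBinom a b                                           ∎
    where open ≡-Reasoning

  *-cancelʳ-qFactorial : ∀ {m n} b → m * qFactorial b ≡ n * qFactorial b → m ≡ n
  *-cancelʳ-qFactorial {m} {n} b = *-cancelʳ-≡ m n (qFactorial b) {{>-nonZero (1≤qFactorial b)}}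

  qFalling-suc-suc≡qBinom : ∀ a b → qFalling (suc a) (suc b) ≡ q^ suc a ∸1 * qBinom a b * qFactorial b
  qFalling-suc-suc≡qBinom a b = begin
    qFalling (suc a) (suc b)                   ≡⟨ qFalling-suc-suc a b ⟩
    q^ suc a ∸1 * qFalling a b                 ≡⟨ cong (q^ suc a ∸1 *_) (qFalling≡qBinom*qFactorial a b) ⟩
    q^ suc a ∸1 * (qBinom a b * qFactorial b)  ≡⟨ sym (*-assoc (q^ suc a ∸1) _ _) ⟩
    q^ suc a ∸1 * qBinom a b * qFactorial b    ∎
    where open ≡-Reasoning

  qBinom-absorb : ∀ a b → qBinom (suc a) (suc b) * q^ suc b ∸1 ≡ q^ suc a ∸1 * qBinom a b
  qBinom-absorb a b = *-cancelʳ-qFactorial b (begin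
    qBinom (suc a) (suc b) * q^ suc b ∸1 * qFactorial b    ≡⟨ *-assoc (qBinom (suc a) (suc b)) _ _ ⟩
    qBinom (suc a) (suc b) * (q^ suc b ∸1 * qFactorial b)  ≡˘⟨ cong (qBinom (suc a) (suc b) *_) (qFalling-suc-suc b b) ⟩
    qBinom (suc a) (suc b) * qFactorial (suc b)            ≡˘⟨ qFalling≡qBinom*qFactorial (suc a) (suc b) ⟩
    qFalling (suc a) (suc b)                               ≡⟨ qFalling-suc-suc≡qBinom a b ⟩
    q^ suc a ∸1 * qBinom a b * qFactorial b                ∎)
    where open ≡-Reasoning

  qBinom-shift : ∀ b a → qBinom (suc (b + a)) b * q^ suc a ∸1 ≡ q^ suc (b + a) ∸1 * qBinom (b + a) b
  qBinom-shift b a = *-cancelʳ-qFactorial b (begin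
    qBinom (suc x) b * q^ suc a ∸1 * qFactorial b    ≡⟨ xy∙z≈xz∙y (qBinom (suc x) b) _ _ ⟩
    qBinom (suc x) b * qFactorial b * q^ suc a ∸1
      ≡˘⟨ cong (_* q^ suc a ∸1) (qFalling≡qBinom*qFactorial (suc x) b) ⟩
    qFalling (suc x) b * q^ suc a ∸1
      ≡˘⟨ cong (λ m → qFalling (suc x) b * q^ m ∸1) (∸-≡ b (+-suc b a)) ⟩
    qFalling (suc x) (suc b)                         ≡⟨ qFalling-suc-suc≡qBinom x b ⟩
    q^ suc x ∸1 * qBinom x b * qFactorial b          ∎)
    where
    open ≡-Reasoning
    x = b + a

  1≤qBinom : ∀ {a b} → b ≤ a → 1 ≤ qBinom a b
  1≤qBinom {a}     {zero}  _         = ≤-refl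
  1≤qBinom {suc a} {suc b} (s≤s b≤a) = ≤-trans (1≤qBinom b≤a) (m≤m+n _ _)

  qBinom[j,1]<q^j : ∀ j → qBinom j 1 < q ^ j
  qBinom[j,1]<q^j zero    = s≤s z≤n
  qBinom[j,1]<q^j (suc j) = begin-strict
    1 + q * 1 * qBinom j 1   ≡⟨ cong (λ u → 1 + u * qBinom j 1) (*-identityʳ q) ⟩
    1 + q * qBinom j 1       <⟨ +-monoˡ-< (q * qBinom j 1) 2≤q ⟩
    q + q * qBinom j 1       ≡˘⟨ *-suc q (qBinom j 1) ⟩
    q * suc (qBinom j 1)     ≤⟨ *-monoʳ-≤ q (qBinom[j,1]<q^j j) ⟩
    q * q ^ j                ∎
    where open ≤-Reasoning

  q^j≤qBinom[1+j,1] : ∀ j → q ^ j ≤ qBinom (suc j) 1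
  q^j≤qBinom[1+j,1] zero    = m≤m+n 1 _
  q^j≤qBinom[1+j,1] (suc j) = begin
    q * q ^ j                      ≤⟨ *-monoʳ-≤ q (q^j≤qBinom[1+j,1] j) ⟩
    q * qBinom (suc j) 1           ≡˘⟨ cong (_* qBinom (suc j) 1) (*-identityʳ q) ⟩
    q * 1 * qBinom (suc j) 1       ≤⟨ m≤n+m _ 1 ⟩
    1 + q * 1 * qBinom (suc j) 1   ∎
    where open ≤-Reasoning

  2≤qBinom[2+j,1] : ∀ j → 2 ≤ qBinom (suc (suc j)) 1
  2≤qBinom[2+j,1] j = ≤-trans 2≤q (≤-trans (m≤m*n q (q ^ j) {{m^n≢0 q j}}) (q^j≤qBinom[1+j,1] (suc j)))

module F1Estimates (q : ℕ) (2≤q : 2 ≤ q) where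
  open GaussianBinomial q 2≤q

  f1≡f1-shape : ∀ {n k} t s x {j m N K} → t + j ≡ x → t + m ≡ k → x + N ≡ n → x + K ≡ k
    → f1 q n k t s x ≡ f1-shape s (qBinom x t) (qBinom (suc m) 1) (qBinom N K) j
  f1≡f1-shape t s x {m = m} {N} {K} t+j≡x t+m≡k x+N≡n x+K≡k
    rewrite ∸-≡ t t+j≡x | ∸-≡ t t+m≡k | ∸-≡ x x+N≡n | ∸-≡ x x+K≡k
          | gauss≡qBinom x t | gauss≡qBinom (suc m) 1 | gauss≡qBinom N K = refl

  degree-comparison : ∀ {A N s} i j k e a M → A < q ^ j → 1 ≤ N → s < q ^ e → i + j + k + e ≤ a + M
    → q^ i ∸1 * A * (N + s) * q^ k ∸1 < q^ suc a ∸1 * q^ suc M ∸1 * N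
  degree-comparison {A} {N} {s} i j k e a M A<q^j 1≤N s<q^e exponent = begin-strict
    q^ i ∸1 * A * (N + s) * q^ k ∸1    ≡⟨ xy∙z≈xz∙y (q^ i ∸1 * A) (N + s) (q^ k ∸1) ⟩
    q^ i ∸1 * A * q^ k ∸1 * (N + s)    ≤⟨ *-monoʳ-≤ (q^ i ∸1 * A * q^ k ∸1) (m+n≤o*m 1≤N s<q^e) ⟩
    q^ i ∸1 * A * q^ k ∸1 * (q ^ e * N) <⟨ *-monoˡ-< (q ^ e * N) {{>-nonZero 1≤q^eN}} numerator< ⟩
    q ^ (i + j + k) * (q ^ e * N)
      ≡˘⟨ trans (cong (_* N) (^-distribˡ-+-* q (i + j + k) e)) (*-assoc (q ^ (i + j + k)) (q ^ e) N) ⟩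
    q ^ (i + j + k + e) * N            ≤⟨ *-monoˡ-≤ N (^-monoʳ-≤ q exponent) ⟩
    q ^ (a + M) * N                    ≡⟨ cong (_* N) (^-distribˡ-+-* q a M) ⟩
    q ^ a * q ^ M * N                  ≤⟨ *-monoˡ-≤ N (*-mono-≤ (q^≤q^suc∸1 a) (q^≤q^suc∸1 M)) ⟩
    q^ suc a ∸1 * q^ suc M ∸1 * N      ∎
    where
    open ≤-Reasoning
    1≤q^eN : 1 ≤ q ^ e * N
    1≤q^eN = *-mono-≤ (m^n>0 q e) 1≤N
    numerator< : q^ i ∸1 * A * q^ k ∸1 < q ^ (i + j + k)
    numerator< = subst (q^ i ∸1 * A * q^ k ∸1 <_) (sym (^-distribˡ-+-*₃ q i j k))
      (*-mono-< (*-mono-< (q^∸1<q^ i) A<q^j) (q^∸1<q^ k))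

  f1-decreasing : ∀ {n k t x e} s → 1 ≤ t → t ≤ x → suc x < k → 2 * k + 2 * t + 1 + e ≡ n → s < q ^ e
    → f1 q n k t s (suc x) < f1 q n k t s x
  f1-decreasing {t = suc t'} {e = e} s (s≤s z≤n) t≤x x+1<k refl s<q^e
    with m≤n⇒∃[o]m+o≡n t≤x | m≤n⇒∃[o]m+o≡n x+1<k
  ... | a , refl | c , refl =
    subst₂ _<_ (sym shape[x+1]) (sym shape[x]) decrease
    where
    t x k n m M A g₀ g₁ N₀ N₁ : ℕ
    t = suc t'
    x = t + a
    k = suc (suc (x + c))
    n = 2 * k + 2 * t + 1 + e
    m = suc (suc (a + c))
    -- M = n ∸ suc x, written so that suc c ≤ M is visible
    M = suc c + (3 * t' + a + c + 6 + e)
    A = qBinom (suc m) 1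
    g₀ = qBinom x t
    g₁ = qBinom (suc x) t
    N₀ = qBinom (suc M) (suc (suc c))
    N₁ = qBinom M (suc c)

    t+m≡k : t + m ≡ k
    t+m≡k = shift t a c
      where
      shift : ∀ t a c → t + suc (suc (a + c)) ≡ suc (suc (t + a + c))
      shift = solve-∀

    n≡ : ∀ t' a c e → suc (suc t' + a) + (suc c + (3 * t' + a + c + 6 + e))
                      ≡ 2 * suc (suc (suc t' + a + c)) + 2 * suc t' + 1 + e
    n≡ = solve-∀

    -- the q-degrees balance up to 2 (t - 1): this is where 1 ≤ t is needed
    exponent : suc x + suc m + suc (suc c) + e ≤ a + M
    exponent = ≤-trans (m≤m+n _ (2 * t')) (≤-reflexive (balance t' a c e))
      where
      balance : ∀ t' a c e → suc (suc t' + a) + suc (suc (suc (a + c))) + suc (suc c) + e + 2 * t'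
                             ≡ a + (suc c + (3 * t' + a + c + 6 + e))
      balance = solve-∀

    1≤N₁ : 1 ≤ N₁
    1≤N₁ = 1≤qBinom (m≤m+n (suc c) (3 * t' + a + c + 6 + e))

    shape[x+1] : f1 q n k t s (suc x) ≡ f1-shape s g₁ A N₁ (suc a)
    shape[x+1] = f1≡f1-shape t s (suc x) (+-suc t a) t+m≡k (n≡ t' a c e) (cong suc (+-suc x c))

    shape[x] : f1 q n k t s x ≡ f1-shape s g₀ A N₀ a
    shape[x] = f1≡f1-shape t s x refl t+m≡k (trans (+-suc x M) (n≡ t' a c e))
                 (trans (+-suc x (suc c)) (cong suc (+-suc x c)))

    decrease : f1-shape s g₁ A N₁ (suc a) < f1-shape s g₀ A N₀ a
    decrease = f1-shape-decreasing s g₀ g₁ A N₀ N₁ {e = q^ suc x ∸1} a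
                 (qBinom-shift t a) (qBinom-absorb M (suc c))
                 (2≤qBinom[2+j,1] (suc (a + c))) (1≤qBinom (m≤m+n t a))
                 (degree-comparison (suc x) (suc m) (suc (suc c)) e a M (qBinom[j,1]<q^j (suc m)) 1≤N₁ s<q^e exponent)

  f1[k∸1]-large : ∀ {n k t e} s l → 1 ≤ t → t < k → 2 * k + 2 * t + 1 + e ≡ n → 7 * s * l ≤ q ^ e
    → 7 * l * (s * gauss q k t * ((2 * k ∸ 2 * t + 2) C (suc (k ∸ t)))) < 6 * f1 q n k t s (k ∸ 1)
  f1[k∸1]-large {t = suc t'} {e = e} s l (s≤s z≤n) t<k refl 7sl≤q^e with m≤n⇒∃[o]m+o≡n t<k
  ... | a , refl = *-cancelʳ-< (q^ suc a ∸1) _ _ (<-≤-trans upper lower)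
    where
    t x k n M binom g A B : ℕ
    t = suc t'
    x = t + a
    k = suc x
    n = 2 * k + 2 * t + 1 + e
    M = k + (2 * t + 1) + e
    binom = (2 * k ∸ 2 * t + 2) C (suc (k ∸ t))
    g = qBinom x t
    A = qBinom (suc (suc a)) 1
    B = q ^ e * (16 * (2 ^ a * 2 ^ a))

    1≤B : 1 ≤ B
    1≤B = *-mono-≤ (m^n>0 q e) (*-mono-≤ {1} {16} (s≤s z≤n) (*-mono-≤ (m^n>0 2 a) (m^n>0 2 a)))

    1≤g : 1 ≤ g
    1≤g = 1≤qBinom (m≤m+n t a)

    upper : 7 * l * (s * gauss q k t * binom) * q^ suc a ∸1 < B * (q ^ k * g)
    upper = begin-strict
      7 * l * (s * gauss q k t * binom) * q^ suc a ∸1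
        ≡⟨ cong (λ G → 7 * l * (s * G * binom) * q^ suc a ∸1) (gauss≡qBinom k t) ⟩
      7 * l * (s * qBinom k t * binom) * q^ suc a ∸1   ≡⟨ regroup l s (qBinom k t) binom (q^ suc a ∸1) ⟩
      7 * s * l * binom * (qBinom k t * q^ suc a ∸1)   ≡⟨ cong (7 * s * l * binom *_) (qBinom-shift t a) ⟩
      7 * s * l * binom * (q^ k ∸1 * g)
        ≤⟨ *-monoˡ-≤ (q^ k ∸1 * g) (*-mono-≤ 7sl≤q^e (binomial-bound t a k (suc (k ∸ t)) (+-suc t a))) ⟩
      B * (q^ k ∸1 * g)
        <⟨ *-monoʳ-< B {{>-nonZero 1≤B}} (*-monoˡ-< g {{>-nonZero 1≤g}} (q^∸1<q^ k)) ⟩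
      B * (q ^ k * g)                                    ∎
      where
      open ≤-Reasoning
      regroup : ∀ l s G B d → 7 * l * (s * G * B) * d ≡ 7 * s * l * B * (G * d)
      regroup = solve-∀

    16≤6*q^[2t+1] : 16 ≤ 6 * q ^ (2 * t + 1)
    16≤6*q^[2t+1] = ≤-trans (m≤m+n 16 32) (*-monoʳ-≤ 6 (≤-trans (^-monoˡ-≤ 3 2≤q)
      (^-monoʳ-≤ q (+-monoˡ-≤ 1 (*-monoʳ-≤ 2 (s≤s {0} {t'} z≤n))))))

    f1[x]≥ : g * A ^ a * q ^ M ≤ f1 q n k t s x
    f1[x]≥ = begin
      g * A ^ a * q ^ M                    ≤⟨ *-monoʳ-≤ (g * A ^ a) (q^j≤qBinom[1+j,1] M) ⟩
      g * A ^ a * qBinom (suc M) 1         ≤⟨ m≤m+n _ _ ⟩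
      f1-shape s g A (qBinom (suc M) 1) a  ≡˘⟨ f1≡f1-shape t s x refl (+-suc t a) (x+[1+M]≡n x t e) (+-comm x 1) ⟩
      f1 q n k t s x                       ∎
      where
      open ≤-Reasoning
      x+[1+M]≡n : ∀ x t e → x + suc (suc x + (2 * t + 1) + e) ≡ 2 * suc x + 2 * t + 1 + e
      x+[1+M]≡n = solve-∀

    lower : B * (q ^ k * g) ≤ 6 * f1 q n k t s x * q^ suc a ∸1
    lower = begin
      q ^ e * (16 * (2 ^ a * 2 ^ a)) * (q ^ k * g)
        ≤⟨ *-monoˡ-≤ (q ^ k * g) (*-monoʳ-≤ (q ^ e)
             (*-mono-≤ 16≤6*q^[2t+1] (*-mono-≤ (^-monoˡ-≤ a (2≤qBinom[2+j,1] a)) (^-monoˡ-≤ a 2≤q)))) ⟩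
      q ^ e * (6 * q ^ (2 * t + 1) * (A ^ a * q ^ a)) * (q ^ k * g)
        ≡⟨ regroup (q ^ e) (q ^ (2 * t + 1)) (A ^ a) (q ^ a) (q ^ k) g ⟩
      6 * (g * A ^ a * (q ^ k * q ^ (2 * t + 1) * q ^ e)) * q ^ a
        ≡˘⟨ cong (λ z → 6 * (g * A ^ a * z) * q ^ a) (^-distribˡ-+-*₃ q k (2 * t + 1) e) ⟩
      6 * (g * A ^ a * q ^ M) * q ^ a
        ≤⟨ *-mono-≤ (*-monoʳ-≤ 6 f1[x]≥) (q^≤q^suc∸1 a) ⟩
      6 * f1 q n k t s x * q^ suc a ∸1  ∎
      where
      open ≤-Reasoning
      regroup : ∀ Qᵉ T Aᵃ Qᵃ Qᵏ g →
        Qᵉ * (6 * T * (Aᵃ * Qᵃ)) * (Qᵏ * g) ≡ 6 * (g * Aᵃ * (Qᵏ * T * Qᵉ)) * Qᵃ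
      regroup = solve-∀

lemma2p4 : (q n k t s l : ℕ) → IsPrimePower q → 1 ≤ n → 1 ≤ k → 1 ≤ t → 1 ≤ s → 1 ≤ l
    → t + 1 ≤ k
    → 2 * k + 2 * t + 1 ≤ n → 7 * s * l ≤ q ^ (n ∸ (2 * k + 2 * t + 1))
    → ((x : ℕ) → t ≤ x → x + 1 ≤ k ∸ 1 → f1 q n k t s (x + 1) < f1 q n k t s x)
      × (7 * l * (s * gauss q k t * ((2 * k ∸ 2 * t + 2) C (suc (k ∸ t)))) < 6 * f1 q n k t s (k ∸ 1))
lemma2p4 q n (suc k) t s l q-primePower _ _ 1≤t 1≤s 1≤l t+1≤k 2k+2t+1≤n 7sl≤q^e =
  decreasing , f1[k∸1]-large s l 1≤t (subst (_≤ suc k) (+-comm t 1) t+1≤k) n≡ 7sl≤q^e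
  where
  open F1Estimates q (2≤primePower q-primePower)
  n≡ : 2 * suc k + 2 * t + 1 + (n ∸ (2 * suc k + 2 * t + 1)) ≡ n
  n≡ = m+[n∸m]≡n 2k+2t+1≤n
  s<7sl : s < 7 * s * l
  s<7sl = <-≤-trans (subst (s <_) (*-comm s 7) (m<m*n s 7 {{>-nonZero 1≤s}} (s≤s (s≤s z≤n))))
                    (m≤m*n (7 * s) l {{>-nonZero 1≤l}})
  decreasing : (x : ℕ) → t ≤ x → x + 1 ≤ k → f1 q n (suc k) t s (x + 1) < f1 q n (suc k) t s x
  decreasing x t≤x x+1≤k =
    subst (λ y → f1 q n (suc k) t s y < f1 q n (suc k) t s x) (+-comm 1 x)
      (f1-decreasing s 1≤t t≤x (s≤s (subst (_≤ k) (+-comm x 1) x+1≤k)) n≡ (<-≤-trans s<7sl 7sl≤q^e))
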